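{- Let $m\ge 1$ and let $x_1,\dots,x_m,y_1,\dots,y_m$ be complex numbers with $1+x_iy_j\ne 0$, $1+x_i\neq 0$, $1+y_j\neq 0$ for all $i,j\in\{1,\dots,m\}$. Let $W_m(\vec x,\vec y)$ be the $(m+1)\times(m+1)$ matrix with rows and columns indexed by $0,\dots,m$, whose $(0,0)$ entry is $0$, whose other entries in row $0$ and column $0$ are all $1$, and whose $(i,j)$ entry is $\frac{x_i+y_j}{1+x_iy_j}$ for $1\le i,j\le m$. Then $$\det W_m(\vec x,\vec y)=-\frac12\Bigl(\prod_{i=1}^{m}(1+x_i)\prod_{j=1}^{m}(1+y_j)-(-1)^m\prod_{i=1}^{m}(1-x_i)\prod_{j=1}^{m}(1-y_j)\Bigr)\prod_{1\le i<j\le m}(x_i-x_j)\prod_{1\le i<j\le m}(y_j-y_i)\prod_{i=1}^{m}\prod_{j=1}^{m}(1+x_iy_j)^{ -1}.$$ -}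

module Defs where

open import Level using (Level; suc; _⊔_)
open import Data.Nat as ℕ using (ℕ; zero)
open import Data.Fin using (Fin; punchIn; _<?_)
import Data.Fin as Fin
open import Data.Bool using (if_then_else_)
open import Relation.Nullary using (¬_; does)
open import Algebra.Bundles using (CommutativeRing)

-- A field: a commutative ring with 0 ≠ 1 and a (total) inverse function
-- that is a multiplicative inverse on nonzero elements (inv 0 is junk).
record Field (c ℓ : Level) : Set (suc (c ⊔ ℓ)) where
  field
    commutativeRing : CommutativeRing c ℓ
  open CommutativeRing commutativeRing public
  field
    inv      : Carrier → Carrier
    0≉1      : ¬ (0# ≈ 1#)
    inverseʳ : ∀ x → ¬ (x ≈ 0#) → x * inv x ≈ 1#

module FieldOps {c ℓ} (F : Field c ℓ) where
  open Field F

  ∏ : ∀ {n} → (Fin n → Carrier) → Carrier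
  ∏ {zero}    f = 1#
  ∏ {ℕ.suc n} f = f Fin.zero * ∏ (λ i → f (Fin.suc i))

  ∏< : ∀ {n} → (Fin n → Fin n → Carrier) → Carrier
  ∏< f = ∏ (λ i → ∏ (λ j → if does (i <? j) then f i j else 1#))

  altSum : ∀ {n} → (Fin n → Carrier) → Carrier
  altSum {zero}    f = 0#
  altSum {ℕ.suc n} f = f Fin.zero - altSum (λ i → f (Fin.suc i))

  pow : Carrier → ℕ → Carrier
  pow a zero      = 1#
  pow a (ℕ.suc k) = a * pow a k

  det : ∀ {n} → (Fin n → Fin n → Carrier) → Carrier
  det {zero}    M = 1#
  det {ℕ.suc n} M =
    altSum (λ j → M Fin.zero j * det (λ a b → M (Fin.suc a) (punchIn j b)))

  -- the (m+1)×(m+1) matrix W_m(x,y); index 0 is the border, suc i ↔ i+1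
  W : ∀ {m} → (Fin m → Carrier) → (Fin m → Carrier) → Fin (ℕ.suc m) → Fin (ℕ.suc m) → Carrier
  W x y Fin.zero    Fin.zero    = 0#
  W x y Fin.zero    (Fin.suc j) = 1#
  W x y (Fin.suc i) Fin.zero    = 1#
  W x y (Fin.suc i) (Fin.suc j) = (x i + y j) * inv (1# + x i * y j)

{-# OPTIONS --safe #-}
-- The determinant of W is affine in its corner entry, so it is the average of the
-- determinants with corner 1 and −1.  With corner −s, where s² = 1, adding s times
-- the border row to the other rows clears the border column and turns the entry
-- (xᵢ + yⱼ)/(1 + xᵢyⱼ) + s into (s + xᵢ)(1 + s yⱼ)/(1 + xᵢyⱼ); what remains is
-- −s ∏(s + xᵢ) ∏(1 + s yⱼ) times the Cauchy-type determinant det (1/(1 + xᵢyⱼ)),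
-- which is evaluated by the same elimination on its first column and induction.
module Submission where

open import Defs
open import Algebra.Bundles using (CommutativeRing)
import Algebra.Solver.Ring.AlmostCommutativeRing as ACR
open import Data.Bool using (if_then_else_)
open import Data.Empty using (⊥-elim)
open import Data.Fin as Fin using (Fin; zero; suc; punchIn; _<?_)
open import Data.Integer as ℤ using (ℤ; +_; -[1+_]; _⊖_)
import Data.Integer.Properties as ℤ
open import Data.Maybe using (Maybe; map)
open import Data.Nat as ℕ using (ℕ; zero; suc; _≥_)
import Data.Nat.Properties as ℕ
open import Data.Sign as Sign using (Sign)
open import Data.Vec.Functional using (_∷_; updateAt)
open import Data.Vec.Functional.Properties using (updateAt-updates; map-updateAt)
open import Function using (_∘_)
open import Relation.Binary.Consequences using (dec⇒weaklyDec)
open import Relation.Binary.PropositionalEquality as ≡ using (_≡_; _≢_)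
open import Relation.Nullary using (¬_; does)

-- The library's ring solver for an arbitrary commutative ring, with coefficients in ℤ
-- (using the ring itself as coefficients would leave constants such as 1# - 1# unreduced).
module IntegerCoefficientSolver {c ℓ} (R : CommutativeRing c ℓ) where
  open CommutativeRing R
  open import Algebra.Properties.Ring ring using (-‿involutive; -0#≈0#; -‿+-comm; -‿distribˡ-*; -‿distribʳ-*)
  open import Algebra.Properties.Semiring.Mult.TCOptimised semiring using (_×_; 1+×; ×-homo-+; ×1-homo-*)
  open import Algebra.Properties.CommutativeSemigroup +-commutativeSemigroup using (interchange)
  open import Relation.Binary.Reasoning.Setoid setoid

  private
    fromℤ : ℤ → Carrier
    fromℤ (+ n)      = n × 1#
    fromℤ (-[1+ n ]) = - (suc n × 1#)

    -‿homo : ∀ i → fromℤ (ℤ.- i) ≈ - fromℤ i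
    -‿homo -[1+ n ]  = sym (-‿involutive _)
    -‿homo (+ zero)  = sym -0#≈0#
    -‿homo (+ suc n) = refl

    ⊖-homo : ∀ m n → fromℤ (m ⊖ n) ≈ m × 1# - n × 1#
    ⊖-homo m       zero    = sym (trans (+-congˡ -0#≈0#) (+-identityʳ _))
    ⊖-homo zero    (suc n) = sym (+-identityˡ _)
    ⊖-homo (suc m) (suc n) = begin
      fromℤ (suc m ⊖ suc n)            ≡⟨ ≡.cong fromℤ (ℤ.[1+m]⊖[1+n]≡m⊖n m n) ⟩
      fromℤ (m ⊖ n)                    ≈⟨ ⊖-homo m n ⟩
      m × 1# - n × 1#                  ≈⟨ +-identityˡ _ ⟨
      0# + (m × 1# - n × 1#)           ≈⟨ +-congʳ (-‿inverseʳ 1#) ⟨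
      (1# - 1#) + (m × 1# - n × 1#)    ≈⟨ interchange _ _ _ _ ⟩
      (1# + m × 1#) + (- 1# - n × 1#)  ≈⟨ +-congˡ (-‿+-comm 1# (n × 1#)) ⟩
      (1# + m × 1#) - (1# + n × 1#)    ≈⟨ +-cong (1+× m 1#) (-‿cong (1+× n 1#)) ⟨
      suc m × 1# - suc n × 1#          ∎

    +-homo : ∀ i j → fromℤ (i ℤ.+ j) ≈ fromℤ i + fromℤ j
    +-homo -[1+ m ] -[1+ n ] = begin
      - (suc (suc (m ℕ.+ n)) × 1#)   ≡⟨ ≡.cong (λ k → - (suc k × 1#)) (ℕ.+-suc m n) ⟨
      - ((suc m ℕ.+ suc n) × 1#)     ≈⟨ -‿cong (×-homo-+ 1# (suc m) (suc n)) ⟩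
      - (suc m × 1# + suc n × 1#)    ≈⟨ -‿+-comm _ _ ⟨
      - (suc m × 1#) - (suc n × 1#)  ∎
    +-homo -[1+ m ] (+ n)    = trans (⊖-homo n (suc m)) (+-comm _ _)
    +-homo (+ m)    -[1+ n ] = ⊖-homo m (suc n)
    +-homo (+ m)    (+ n)    = ×-homo-+ 1# m n

    signed : Sign → Carrier → Carrier
    signed Sign.+ x = x
    signed Sign.- x = - x

    signed-cong : ∀ s {x y} → x ≈ y → signed s x ≈ signed s y
    signed-cong Sign.+ x≈y = x≈y
    signed-cong Sign.- x≈y = -‿cong x≈y

    signed-* : ∀ s t x y → signed (s Sign.* t) (x * y) ≈ signed s x * signed t y
    signed-* Sign.+ Sign.+ x y = refl
    signed-* Sign.+ Sign.- x y = -‿distribʳ-* x y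
    signed-* Sign.- Sign.+ x y = -‿distribˡ-* x y
    signed-* Sign.- Sign.- x y = begin
      x * y        ≈⟨ -‿involutive _ ⟨
      - - (x * y)  ≈⟨ -‿cong (-‿distribˡ-* x y) ⟩
      - (- x * y)  ≈⟨ -‿distribʳ-* (- x) y ⟩
      - x * - y    ∎

    ◃-homo : ∀ s n → fromℤ (s ℤ.◃ n) ≈ signed s (n × 1#)
    ◃-homo Sign.+ n = reflexive (≡.cong fromℤ (ℤ.+◃n≡+n n))
    ◃-homo Sign.- n = trans (reflexive (≡.cong fromℤ (ℤ.-◃n≡-n n))) (-‿homo (+ n))

    fromℤ-signAbs : ∀ i → fromℤ i ≈ signed (ℤ.sign i) (ℤ.∣ i ∣ × 1#)
    fromℤ-signAbs (+ n)    = refl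
    fromℤ-signAbs -[1+ n ] = refl

    *-homo : ∀ i j → fromℤ (i ℤ.* j) ≈ fromℤ i * fromℤ j
    *-homo i j = begin
      fromℤ (s ℤ.◃ ∣i∣ ℕ.* ∣j∣)                                    ≈⟨ ◃-homo s (∣i∣ ℕ.* ∣j∣) ⟩
      signed s ((∣i∣ ℕ.* ∣j∣) × 1#)                                ≈⟨ signed-cong s (×1-homo-* ∣i∣ ∣j∣) ⟩
      signed s (∣i∣ × 1# * ∣j∣ × 1#)                               ≈⟨ signed-* (ℤ.sign i) (ℤ.sign j) _ _ ⟩
      signed (ℤ.sign i) (∣i∣ × 1#) * signed (ℤ.sign j) (∣j∣ × 1#)  ≈⟨ *-cong (fromℤ-signAbs i) (fromℤ-signAbs j) ⟨
      fromℤ i * fromℤ j                                            ∎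
      where
      s = ℤ.sign i Sign.* ℤ.sign j
      ∣i∣ = ℤ.∣ i ∣
      ∣j∣ = ℤ.∣ j ∣

    homomorphism : ℤ.+-*-rawRing ACR.-Raw-AlmostCommutative⟶ ACR.fromCommutativeRing R
    homomorphism = record
      { ⟦_⟧ = fromℤ ; +-homo = +-homo ; *-homo = *-homo ; -‿homo = -‿homo
      ; 0-homo = refl ; 1-homo = refl }

    ≡⇒≈ : ∀ i j → Maybe (fromℤ i ≈ fromℤ j)
    ≡⇒≈ i j = map (λ { ≡.refl → refl }) (dec⇒weaklyDec ℤ._≟_ i j)

  open import Algebra.Solver.Ring ℤ.+-*-rawRing (ACR.fromCommutativeRing R) homomorphism ≡⇒≈ public

module Determinant {c ℓ} (F : Field c ℓ) where
  open Field F hiding (zero)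
  open FieldOps F
  open IntegerCoefficientSolver commutativeRing using (solve; _:=_; _:+_; _:*_; _:-_; :-_; con)
  open import Algebra.Properties.Ring ring using (-0#≈0#; -1*x≈-x)
  open import Algebra.Properties.Semiring.Sum semiring using (sum; sum-cong-≋; ∑-distrib-+; *-distribˡ-sum)
  open import Algebra.Properties.CommutativeMonoid.Sum *-commutativeMonoid
    using () renaming ( sum to product; sum-cong-≋ to product-cong
                      ; ∑-distrib-+ to product-distrib; sum-remove to product-remove )
  open import Relation.Binary.Reasoning.Setoid setoid

  x-0≈x : ∀ x → x - 0# ≈ x
  x-0≈x x = trans (+-congˡ -0#≈0#) (+-identityʳ x)

  *≈0ʳ : ∀ x {y} → y ≈ 0# → x * y ≈ 0#
  *≈0ʳ x y≈0 = trans (*-congˡ y≈0) (zeroʳ x)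

  sum-zero : ∀ {n} {f : Fin n → Carrier} → (∀ i → f i ≈ 0#) → sum f ≈ 0#
  sum-zero {zero}  f≈0 = refl
  sum-zero {suc n} f≈0 = trans (+-cong (f≈0 zero) (sum-zero (f≈0 ∘ suc))) (+-identityʳ 0#)

  altSum-cong : ∀ {n} {f g : Fin n → Carrier} → (∀ j → f j ≈ g j) → altSum f ≈ altSum g
  altSum-cong {zero}  f≈g = refl
  altSum-cong {suc n} f≈g = +-cong (f≈g zero) (-‿cong (altSum-cong (f≈g ∘ suc)))

  altSum-zero : ∀ {n} (f : Fin n → Carrier) → (∀ j → f j ≈ 0#) → altSum f ≈ 0#
  altSum-zero {zero}  f f≈0 = refl
  altSum-zero {suc n} f f≈0 = begin
    f zero - altSum (f ∘ suc)  ≈⟨ +-cong (f≈0 zero) (-‿cong (altSum-zero (f ∘ suc) (f≈0 ∘ suc))) ⟩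
    0# - 0#                    ≈⟨ x-0≈x 0# ⟩
    0#                         ∎

  altSum-+ : ∀ {n} (f g : Fin n → Carrier) → altSum (λ j → f j + g j) ≈ altSum f + altSum g
  altSum-+ {zero}  f g = sym (+-identityˡ 0#)
  altSum-+ {suc n} f g = trans (+-congˡ (-‿cong (altSum-+ (f ∘ suc) (g ∘ suc))))
    (solve 4 (λ a b c d → (a :+ b) :- (c :+ d) := (a :- c) :+ (b :- d)) refl _ _ _ _)

  altSum-scale : ∀ {n} p (f : Fin n → Carrier) → altSum (λ j → p * f j) ≈ p * altSum f
  altSum-scale {zero}  p f = sym (zeroʳ p)
  altSum-scale {suc n} p f = trans (+-congˡ (-‿cong (altSum-scale p (f ∘ suc))))
    (solve 3 (λ p a b → p :* a :- p :* b := p :* (a :- b)) refl _ _ _)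

  altSum-neg : ∀ {n} (f : Fin n → Carrier) → altSum (λ j → - f j) ≈ - altSum f
  altSum-neg f = trans (altSum-cong (λ j → sym (-1*x≈-x (f j)))) (trans (altSum-scale (- 1#) f) (-1*x≈-x _))

  altSum-sum : ∀ {m n} (g : Fin m → Fin n → Carrier) →
    altSum (λ j → sum (g j)) ≈ sum (λ i → altSum (λ j → g j i))
  altSum-sum {zero} {n} g = sym (sum-zero {n} (λ _ → refl))
  altSum-sum {suc m} {n} g = begin
    sum (g zero) - altSum (λ j → sum (g (suc j)))
      ≈⟨ +-congˡ (-‿cong (altSum-sum (g ∘ suc))) ⟩
    sum (g zero) - sum (λ i → altSum (λ j → g (suc j) i))
      ≈⟨ +-congˡ (-1*x≈-x _) ⟨
    sum (g zero) + - 1# * sum (λ i → altSum (λ j → g (suc j) i))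
      ≈⟨ +-congˡ (*-distribˡ-sum (- 1#) (λ i → altSum (λ j → g (suc j) i))) ⟩
    sum (g zero) + sum (λ i → - 1# * altSum (λ j → g (suc j) i))
      ≈⟨ ∑-distrib-+ (g zero) _ ⟨
    sum (λ i → g zero i + - 1# * altSum (λ j → g (suc j) i))
      ≈⟨ sum-cong-≋ (λ i → +-congˡ (-1*x≈-x (altSum (λ j → g (suc j) i)))) ⟩
    sum (λ i → altSum (λ j → g j i)) ∎

  ∏≡product : ∀ {n} (f : Fin n → Carrier) → ∏ f ≡ product f
  ∏≡product {zero}  f = ≡.refl
  ∏≡product {suc n} f = ≡.cong (f zero *_) (∏≡product (f ∘ suc))

  ∏-cong : ∀ {n} {f g : Fin n → Carrier} → (∀ i → f i ≈ g i) → ∏ f ≈ ∏ g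
  ∏-cong {f = f} {g} f≈g = begin
    ∏ f        ≡⟨ ∏≡product f ⟩
    product f  ≈⟨ product-cong f≈g ⟩
    product g  ≡⟨ ∏≡product g ⟨
    ∏ g        ∎

  ∏-* : ∀ {n} (f g : Fin n → Carrier) → ∏ (λ i → f i * g i) ≈ ∏ f * ∏ g
  ∏-* f g = begin
    ∏ (λ i → f i * g i)        ≡⟨ ∏≡product (λ i → f i * g i) ⟩
    product (λ i → f i * g i)  ≈⟨ product-distrib f g ⟩
    product f * product g      ≡⟨ ≡.cong₂ _*_ (∏≡product f) (∏≡product g) ⟨
    ∏ f * ∏ g                  ∎

  ∏-punchIn : ∀ {n} (f : Fin (suc n) → Carrier) j → ∏ f ≈ f j * ∏ (f ∘ punchIn j)
  ∏-punchIn f j = begin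
    ∏ f                            ≡⟨ ∏≡product f ⟩
    product f                      ≈⟨ product-remove {i = j} f ⟩
    f j * product (f ∘ punchIn j)  ≡⟨ ≡.cong (f j *_) (∏≡product (f ∘ punchIn j)) ⟨
    f j * ∏ (f ∘ punchIn j)        ∎

  ∏-neg : ∀ {n} (f : Fin n → Carrier) → ∏ (λ i → - f i) ≈ pow (- 1#) n * ∏ f
  ∏-neg {zero}  f = sym (*-identityˡ 1#)
  ∏-neg {suc n} f = trans (*-congˡ (∏-neg (f ∘ suc)))
    (solve 3 (λ a p q → (:- a) :* (p :* q) := (:- con (+ 1) :* p) :* (a :* q))
      refl (f zero) (pow (- 1#) n) (∏ (f ∘ suc)))

  ∏<-split : ∀ {n} (f : Fin (suc n) → Fin (suc n) → Carrier) →
    ∏< f ≈ ∏ (λ j → f zero (suc j)) * ∏< (λ i j → f (suc i) (suc j))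
  ∏<-split f = *-cong (*-identityˡ _)
    (∏-cong (λ i → *-identityˡ (∏ (λ j → if does (i <? j) then f (suc i) (suc j) else 1#))))

  Matrix : ℕ → Set c
  Matrix n = Fin n → Fin n → Carrier

  minor : ∀ {n} → Matrix (suc n) → Fin (suc n) → Matrix n
  minor M j a b = M (suc a) (punchIn j b)

  det-cong : ∀ {n} {M N : Matrix n} → (∀ a b → M a b ≈ N a b) → det M ≈ det N
  det-cong {zero}  M≈N = refl
  det-cong {suc n} M≈N =
    altSum-cong (λ j → *-cong (M≈N zero j) (det-cong (λ a b → M≈N (suc a) (punchIn j b))))

  -- Laplace expansion along two rows A, B, where Φ σ stands for the determinant of the
  -- remaining rows restricted to the columns σ; det M unfolds to expand₂ (M 0) (M 1) (lowerRows M).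
  expand₂ : ∀ {K} (A B : Fin (suc (suc K)) → Carrier) →
    ((Fin K → Fin (suc (suc K))) → Carrier) → Carrier
  expand₂ A B Φ = altSum (λ j → A j * altSum (λ k → B (punchIn j k) * Φ (punchIn j ∘ punchIn k)))

  Extensional : ∀ {K N} → ((Fin K → Fin N) → Carrier) → Set _
  Extensional Φ = ∀ σ τ → (∀ b → σ b ≡ τ b) → Φ σ ≈ Φ τ

  lift-extensional : ∀ {K N} {Φ : (Fin (suc K) → Fin (suc N)) → Carrier} →
    Extensional Φ → Extensional (Φ ∘ Fin.lift 1)
  lift-extensional ext σ τ σ≗τ = ext _ _ λ { zero → ≡.refl ; (suc b) → ≡.cong suc (σ≗τ b) }

  expand₂-suc : ∀ {K} (A B : Fin (suc (suc (suc K))) → Carrier) Φ → Extensional Φ →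
    let Y = λ k → Φ (suc ∘ punchIn k) in
    expand₂ A B Φ ≈ A zero * altSum (λ k → B (suc k) * Y k)
                    - (B zero * altSum (λ k → A (suc k) * Y k) - expand₂ (A ∘ suc) (B ∘ suc) (Φ ∘ Fin.lift 1))
  expand₂-suc A B Φ ext = +-congˡ (-‿cong (begin
    altSum (λ j → A (suc j) * (B zero * Y j - altSum (λ k → B (suc (punchIn j k)) * Φ (punchIn (suc j) ∘ punchIn (suc k)))))
      ≈⟨ altSum-cong split ⟩
    altSum (λ j → B zero * (A (suc j) * Y j) + - (A (suc j) * Z j))
      ≈⟨ altSum-+ (λ j → B zero * (A (suc j) * Y j)) (λ j → - (A (suc j) * Z j)) ⟩
    altSum (λ j → B zero * (A (suc j) * Y j)) + altSum (λ j → - (A (suc j) * Z j))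
      ≈⟨ +-cong (altSum-scale (B zero) (λ j → A (suc j) * Y j)) (altSum-neg (λ j → A (suc j) * Z j)) ⟩
    B zero * altSum (λ k → A (suc k) * Y k) - expand₂ (A ∘ suc) (B ∘ suc) (Φ ∘ Fin.lift 1) ∎))
    where
    Y = λ k → Φ (suc ∘ punchIn k)
    Z = λ j → altSum (λ k → B (suc (punchIn j k)) * Φ (Fin.lift 1 (punchIn j ∘ punchIn k)))

    columns : ∀ j k b → punchIn (suc j) (punchIn (suc k) b) ≡ Fin.lift 1 (punchIn j ∘ punchIn k) b
    columns j k zero    = ≡.refl
    columns j k (suc b) = ≡.refl

    inner : ∀ j → altSum (λ k → B (suc (punchIn j k)) * Φ (punchIn (suc j) ∘ punchIn (suc k))) ≈ Z j
    inner j = altSum-cong (λ k → *-congˡ {B (suc (punchIn j k))} (ext _ _ (columns j k)))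

    split : ∀ j → A (suc j) * (B zero * Y j - altSum (λ k → B (suc (punchIn j k)) * Φ (punchIn (suc j) ∘ punchIn (suc k))))
                  ≈ B zero * (A (suc j) * Y j) + - (A (suc j) * Z j)
    split j = trans (*-congˡ (+-congˡ (-‿cong (inner j))))
      (solve 4 (λ a b y z → a :* (b :* y :- z) := b :* (a :* y) :+ :- (a :* z)) refl (A (suc j)) (B zero) (Y j) (Z j))

  expand₂-antisym : ∀ {K} (A B : Fin (suc (suc K)) → Carrier) Φ → Extensional Φ →
    expand₂ A B Φ + expand₂ B A Φ ≈ 0#
  -- For K = 0 both column selections are suc ∘ suc definitionally, so Φ is not compared.
  expand₂-antisym {zero} A B Φ _ =
    solve 5 (λ a₀ a₁ b₀ b₁ p → (a₀ :* (b₁ :* p :- con (+ 0)) :- (a₁ :* (b₀ :* p :- con (+ 0)) :- con (+ 0)))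
              :+ (b₀ :* (a₁ :* p :- con (+ 0)) :- (b₁ :* (a₀ :* p :- con (+ 0)) :- con (+ 0))) := con (+ 0))
      refl (A zero) (A (suc zero)) (B zero) (B (suc zero)) (Φ (punchIn zero ∘ punchIn zero))
  expand₂-antisym {suc K} A B Φ ext = begin
    expand₂ A B Φ + expand₂ B A Φ
      ≈⟨ +-cong (expand₂-suc A B Φ ext) (expand₂-suc B A Φ ext) ⟩
    (A zero * T-B - (B zero * T-A - S-AB)) + (B zero * T-A - (A zero * T-B - S-BA))
      ≈⟨ solve 6 (λ a b ta tb s t → (a :* tb :- (b :* ta :- s)) :+ (b :* ta :- (a :* tb :- t)) := s :+ t)
           refl (A zero) (B zero) T-A T-B S-AB S-BA ⟩
    S-AB + S-BA
      ≈⟨ expand₂-antisym (A ∘ suc) (B ∘ suc) (Φ ∘ Fin.lift 1) (lift-extensional ext) ⟩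
    0# ∎
    where
    T-A = altSum (λ k → A (suc k) * Φ (suc ∘ punchIn k))
    T-B = altSum (λ k → B (suc k) * Φ (suc ∘ punchIn k))
    S-AB = expand₂ (A ∘ suc) (B ∘ suc) (Φ ∘ Fin.lift 1)
    S-BA = expand₂ (B ∘ suc) (A ∘ suc) (Φ ∘ Fin.lift 1)

  expand₂-diagonal : ∀ {K} (A B : Fin (suc (suc K)) → Carrier) Φ → Extensional Φ →
    (∀ j → A j ≈ B j) → expand₂ A B Φ ≈ 0#
  expand₂-diagonal {zero} A B Φ _ A≈B = begin
    a₀ * (B (suc zero) * p - 0#) - (a₁ * (B zero * p - 0#) - 0#)
      ≈⟨ +-congˡ (-‿cong (+-congʳ (*-congˡ (+-congʳ (*-congʳ (sym (A≈B zero))))))) ⟩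
    a₀ * (B (suc zero) * p - 0#) - (a₁ * (a₀ * p - 0#) - 0#)
      ≈⟨ +-congʳ (*-congˡ (+-congʳ (*-congʳ (sym (A≈B (suc zero)))))) ⟩
    a₀ * (a₁ * p - 0#) - (a₁ * (a₀ * p - 0#) - 0#)
      ≈⟨ solve 3 (λ a₀ a₁ p → a₀ :* (a₁ :* p :- con (+ 0)) :- (a₁ :* (a₀ :* p :- con (+ 0)) :- con (+ 0)) := con (+ 0))
           refl a₀ a₁ p ⟩
    0# ∎
    where
    a₀ = A zero ; a₁ = A (suc zero)
    p = Φ (punchIn zero ∘ punchIn zero)
  expand₂-diagonal {suc K} A B Φ ext A≈B = begin
    expand₂ A B Φ
      ≈⟨ expand₂-suc A B Φ ext ⟩
    A zero * T-B - (B zero * T-A - S)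
      ≈⟨ +-cong (*-congˡ T-B≈T-A) (-‿cong (+-cong (*-congʳ (sym (A≈B zero))) (-‿cong S≈0))) ⟩
    A zero * T-A - (A zero * T-A - 0#)
      ≈⟨ solve 1 (λ t → t :- (t :- con (+ 0)) := con (+ 0)) refl (A zero * T-A) ⟩
    0# ∎
    where
    T-A = altSum (λ k → A (suc k) * Φ (suc ∘ punchIn k))
    T-B = altSum (λ k → B (suc k) * Φ (suc ∘ punchIn k))
    S = expand₂ (A ∘ suc) (B ∘ suc) (Φ ∘ Fin.lift 1)
    T-B≈T-A : T-B ≈ T-A
    T-B≈T-A = altSum-cong (λ k → *-congʳ {Φ (suc ∘ punchIn k)} (sym (A≈B (suc k))))
    S≈0 : S ≈ 0#
    S≈0 = expand₂-diagonal (A ∘ suc) (B ∘ suc) (Φ ∘ Fin.lift 1) (lift-extensional ext) (A≈B ∘ suc)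

  lowerRows : ∀ {n} → Matrix (suc (suc n)) → (Fin n → Fin (suc (suc n))) → Carrier
  lowerRows M σ = det (λ a b → M (suc (suc a)) (σ b))

  lowerRows-extensional : ∀ {n} (M : Matrix (suc (suc n))) → Extensional (lowerRows M)
  lowerRows-extensional M σ τ σ≗τ = det-cong (λ a b → reflexive (≡.cong (M (suc (suc a))) (σ≗τ b)))

  swapRows₀₁ : ∀ {n} → Matrix (suc (suc n)) → Matrix (suc (suc n))
  swapRows₀₁ M zero          = M (suc zero)
  swapRows₀₁ M (suc zero)    = M zero
  swapRows₀₁ M (suc (suc a)) = M (suc (suc a))

  det-swapRows₀₁ : ∀ {n} (M : Matrix (suc (suc n))) → det M + det (swapRows₀₁ M) ≈ 0#
  det-swapRows₀₁ M = expand₂-antisym (M zero) (M (suc zero)) (lowerRows M) (lowerRows-extensional M)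

  EqualRows : ∀ {n} → Matrix n → Fin n → Fin n → Set ℓ
  EqualRows M r s = ∀ b → M r b ≈ M s b

  det-equalRows : ∀ {n} (M : Matrix n) {r s} → r ≢ s → EqualRows M r s → det M ≈ 0#
  det-equalLowerRows : ∀ {n} (M : Matrix (suc n)) {r s} → r ≢ s → EqualRows M (suc r) (suc s) → det M ≈ 0#
  det-equalFirstRow : ∀ {n} (M : Matrix (suc n)) s → EqualRows M zero (suc s) → det M ≈ 0#

  det-equalRows {suc n} M {zero}  {zero}  r≢s _  = ⊥-elim (r≢s ≡.refl)
  det-equalRows {suc n} M {zero}  {suc s} _   eq = det-equalFirstRow M s eq
  det-equalRows {suc n} M {suc r} {zero}  _   eq = det-equalFirstRow M r (sym ∘ eq)
  det-equalRows {suc n} M {suc r} {suc s} r≢s eq = det-equalLowerRows M (r≢s ∘ ≡.cong suc) eq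

  det-equalLowerRows M r≢s eq =
    altSum-zero _ (λ j → *≈0ʳ (M zero j) (det-equalRows (minor M j) r≢s (eq ∘ punchIn j)))

  det-equalFirstRow {suc n} M zero eq =
    expand₂-diagonal (M zero) (M (suc zero)) (lowerRows M) (lowerRows-extensional M) eq
  det-equalFirstRow {suc n} M (suc s) eq = begin
    det M
      ≈⟨ solve 2 (λ d e → d := (d :+ e) :- e) refl (det M) (det M′) ⟩
    (det M + det M′) - det M′
      ≈⟨ +-cong (det-swapRows₀₁ M) (-‿cong (det-equalLowerRows M′ {zero} {suc s} (λ ()) eq)) ⟩
    0# - 0#
      ≈⟨ x-0≈x 0# ⟩
    0# ∎
    where
    M′ = swapRows₀₁ M

  replaceRow : ∀ {n} → Matrix n → Fin n → (Fin n → Carrier) → Matrix n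
  replaceRow M i w = updateAt M i (λ _ → w)

  minor-replaceRow : ∀ {n} (N : Matrix (suc n)) i j (w : Fin (suc n) → Carrier) a b →
    minor (replaceRow N (suc i) w) j a b ≡ replaceRow (minor N j) i (w ∘ punchIn j) a b
  minor-replaceRow N i j w a b =
    ≡.cong (λ row → row b) (map-updateAt {f = λ row → row ∘ punchIn j} (λ _ → ≡.refl) (N ∘ suc) i a)

  det-replaceRow-byFirstRow : ∀ {n} (M : Matrix (suc n)) i → det (replaceRow M (suc i) (M zero)) ≈ 0#
  det-replaceRow-byFirstRow M i = det-equalRows (replaceRow M (suc i) (M zero)) {zero} {suc i} (λ ())
    (λ b → reflexive (≡.sym (≡.cong (λ row → row b) (updateAt-updates i (M ∘ suc)))))

  -- Expanding along the first row, the terms of degree two in w are determinants with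
  -- w in rows 0 and i + 1, so they vanish.
  det-rankOneUpdate : ∀ {n} (N : Matrix n) (μ w : Fin n → Carrier) →
    det (λ a b → N a b + μ a * w b) ≈ det N + sum (λ i → μ i * det (replaceRow N i w))
  det-rankOneUpdate {zero}  N μ w = sym (+-identityʳ 1#)
  det-rankOneUpdate {suc n} N μ w = begin
    altSum (λ j → (N zero j + μ zero * w j) * det (λ a b → minor N j a b + μ′ a * w (punchIn j b)))
      ≈⟨ altSum-cong expand ⟩
    altSum (λ j → (N zero j * d j + N zero j * s j) + μ zero * (w j * d j + w j * s j))
      ≈⟨ altSum-+ (λ j → N zero j * d j + N zero j * s j) (λ j → μ zero * (w j * d j + w j * s j)) ⟩
    altSum (λ j → N zero j * d j + N zero j * s j) + altSum (λ j → μ zero * (w j * d j + w j * s j))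
      ≈⟨ +-cong (altSum-+ (λ j → N zero j * d j) (λ j → N zero j * s j))
                (trans (altSum-scale (μ zero) (λ j → w j * d j + w j * s j))
                       (*-congˡ (altSum-+ (λ j → w j * d j) (λ j → w j * s j)))) ⟩
    (det N + altSum (λ j → N zero j * s j)) + μ zero * (det (replaceRow N zero w) + altSum (λ j → w j * s j))
      ≈⟨ +-cong (+-congˡ (mixedTerms (N zero))) (*-congˡ (+-congˡ (trans (mixedTerms w) (sum-zero repeatedW)))) ⟩
    (det N + sum (λ i → μ′ i * det (replaceRow N (suc i) w))) + μ zero * (det (replaceRow N zero w) + 0#)
      ≈⟨ solve 4 (λ a b m c → (a :+ b) :+ m :* (c :+ con (+ 0)) := a :+ (m :* c :+ b)) refl _ _ _ _ ⟩
    det N + sum (λ i → μ i * det (replaceRow N i w)) ∎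
    where
    μ′ = μ ∘ suc
    d = λ j → det (minor N j)
    e = λ i j → det (replaceRow (minor N j) i (w ∘ punchIn j))
    s = λ j → sum (λ i → μ′ i * e i j)

    expand : ∀ j → (N zero j + μ zero * w j) * det (λ a b → minor N j a b + μ′ a * w (punchIn j b))
                   ≈ (N zero j * d j + N zero j * s j) + μ zero * (w j * d j + w j * s j)
    expand j = trans (*-congˡ (det-rankOneUpdate (minor N j) μ′ (w ∘ punchIn j)))
      (solve 5 (λ a m w d s → (a :+ m :* w) :* (d :+ s) := (a :* d :+ a :* s) :+ m :* (w :* d :+ w :* s))
        refl (N zero j) (μ zero) (w j) (d j) (s j))

    mixedTerms : ∀ v → altSum (λ j → v j * s j) ≈ sum (λ i → μ′ i * det (replaceRow (replaceRow N zero v) (suc i) w))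
    mixedTerms v = begin
      altSum (λ j → v j * s j)
        ≈⟨ altSum-cong (λ j → trans (*-distribˡ-sum (v j) (λ i → μ′ i * e i j))
                                    (sum-cong-≋ (λ i → swap (v j) (μ′ i) (e i j)))) ⟩
      altSum (λ j → sum (λ i → μ′ i * (v j * e i j)))
        ≈⟨ altSum-sum (λ j i → μ′ i * (v j * e i j)) ⟩
      sum (λ i → altSum (λ j → μ′ i * (v j * e i j)))
        ≈⟨ sum-cong-≋ (λ i → altSum-scale (μ′ i) (λ j → v j * e i j)) ⟩
      sum (λ i → μ′ i * altSum (λ j → v j * e i j))
        ≈⟨ sum-cong-≋ (λ i → *-congˡ (altSum-cong (λ j → *-congˡ {v j} (det-cong (minor-replaceRow′ i j))))) ⟩
      sum (λ i → μ′ i * det (replaceRow (replaceRow N zero v) (suc i) w)) ∎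
      where
      swap : ∀ a b c → a * (b * c) ≈ b * (a * c)
      swap = solve 3 (λ a b c → a :* (b :* c) := b :* (a :* c)) refl
      minor-replaceRow′ : ∀ i j a b → replaceRow (minor N j) i (w ∘ punchIn j) a b ≈ minor (replaceRow N (suc i) w) j a b
      minor-replaceRow′ i j a b = reflexive (≡.sym (minor-replaceRow N i j w a b))

    repeatedW : ∀ i → μ′ i * det (replaceRow (replaceRow N zero w) (suc i) w) ≈ 0#
    repeatedW i = *≈0ʳ (μ′ i) (det-replaceRow-byFirstRow (replaceRow N zero w) i)

  det-addMultiplesOfFirstRow : ∀ {n} (M : Matrix (suc n)) (l : Fin n → Carrier) →
    det (λ a b → M a b + (0# ∷ l) a * M zero b) ≈ det M
  det-addMultiplesOfFirstRow M l = begin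
    det (λ a b → M a b + (0# ∷ l) a * M zero b)
      ≈⟨ det-rankOneUpdate M (0# ∷ l) (M zero) ⟩
    det M + (0# * det (replaceRow M zero (M zero)) + sum (λ i → l i * det (replaceRow M (suc i) (M zero))))
      ≈⟨ +-congˡ (+-cong (zeroˡ _) (sum-zero (λ i → *≈0ʳ (l i) (det-replaceRow-byFirstRow M i)))) ⟩
    det M + (0# + 0#)
      ≈⟨ +-congˡ (+-identityʳ 0#) ⟩
    det M + 0#
      ≈⟨ +-identityʳ (det M) ⟩
    det M ∎

  det-expandFirstColumn : ∀ {n} (M : Matrix (suc n)) → (∀ a → M (suc a) zero ≈ 0#) →
    det M ≈ M zero zero * det (λ a b → M (suc a) (suc b))
  det-expandFirstColumn {zero}  M _ = x-0≈x _
  det-expandFirstColumn {suc n} M col≈0 = begin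
    M zero zero * det (minor M zero) - altSum (λ j → M zero (suc j) * det (minor M (suc j)))
      ≈⟨ +-congˡ (-‿cong (altSum-zero _ (λ j → *≈0ʳ (M zero (suc j)) (minor-singular j)))) ⟩
    M zero zero * det (minor M zero) - 0#
      ≈⟨ x-0≈x _ ⟩
    M zero zero * det (minor M zero) ∎
    where
    minor-singular : ∀ j → det (minor M (suc j)) ≈ 0#
    minor-singular j = trans (det-expandFirstColumn (minor M (suc j)) (col≈0 ∘ suc))
                             (trans (*-congʳ (col≈0 zero)) (zeroˡ _))

  det-scaleRows : ∀ {n} (r : Fin n → Carrier) (M : Matrix n) → det (λ a b → r a * M a b) ≈ ∏ r * det M
  det-scaleRows {zero}  r M = sym (*-identityˡ 1#)
  det-scaleRows {suc n} r M = begin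
    altSum (λ j → r zero * M zero j * det (λ a b → r (suc a) * minor M j a b))
      ≈⟨ altSum-cong (λ j → *-congˡ {r zero * M zero j} (det-scaleRows (r ∘ suc) (minor M j))) ⟩
    altSum (λ j → r zero * M zero j * (∏ (r ∘ suc) * det (minor M j)))
      ≈⟨ altSum-cong (λ j → regroup (r zero) (M zero j) (∏ (r ∘ suc)) (det (minor M j))) ⟩
    altSum (λ j → ∏ r * (M zero j * det (minor M j)))
      ≈⟨ altSum-scale (∏ r) (λ j → M zero j * det (minor M j)) ⟩
    ∏ r * det M ∎
    where
    regroup : ∀ a m p d → a * m * (p * d) ≈ (a * p) * (m * d)
    regroup = solve 4 (λ a m p d → a :* m :* (p :* d) := (a :* p) :* (m :* d)) refl

  det-scaleColumns : ∀ {n} (k : Fin n → Carrier) (M : Matrix n) → det (λ a b → M a b * k b) ≈ ∏ k * det M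
  det-scaleColumns {zero}  k M = sym (*-identityˡ 1#)
  det-scaleColumns {suc n} k M = begin
    altSum (λ j → M zero j * k j * det (λ a b → minor M j a b * k (punchIn j b)))
      ≈⟨ altSum-cong (λ j → *-congˡ {M zero j * k j} (det-scaleColumns (k ∘ punchIn j) (minor M j))) ⟩
    altSum (λ j → M zero j * k j * (∏ (k ∘ punchIn j) * det (minor M j)))
      ≈⟨ altSum-cong (λ j → trans (regroup (M zero j) (k j) (∏ (k ∘ punchIn j)) (det (minor M j)))
                                  (*-congʳ (sym (∏-punchIn k j)))) ⟩
    altSum (λ j → ∏ k * (M zero j * det (minor M j)))
      ≈⟨ altSum-scale (∏ k) (λ j → M zero j * det (minor M j)) ⟩
    ∏ k * det M ∎
    where
    regroup : ∀ m x p d → m * x * (p * d) ≈ (x * p) * (m * d)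
    regroup = solve 4 (λ m x p d → m :* x :* (p :* d) := (x :* p) :* (m :* d)) refl

module Cauchy {c ℓ} (F : Field c ℓ) where
  open Field F hiding (zero)
  open FieldOps F
  open Determinant F
  open IntegerCoefficientSolver commutativeRing using (solve; _:=_; _:+_; _:*_; _:-_; :-_; con)
  open import Relation.Binary.Reasoning.Setoid setoid

  cauchy : ∀ {n} → (Fin n → Carrier) → (Fin n → Carrier) → Matrix n
  cauchy x y a b = inv (1# + x a * y b)

  cauchy-elimination : ∀ xₐ x₀ y_b y₀ {u v w} →
    (1# + xₐ * y₀) * u ≈ 1# → (1# + x₀ * y_b) * v ≈ 1# → (1# + xₐ * y_b) * w ≈ 1# →
    w + (- ((1# + x₀ * y₀) * u)) * v ≈ ((x₀ - xₐ) * u) * w * ((y_b - y₀) * v)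
  cauchy-elimination xₐ x₀ y_b y₀ {u} {v} {w} u-inv v-inv w-inv = sym (begin
    ((x₀ - xₐ) * u) * w * ((y_b - y₀) * v)
      ≈⟨ solve 7 (λ xₐ x₀ y_b y₀ u v w → ((x₀ :- xₐ) :* u) :* w :* ((y_b :- y₀) :* v)
           := ((con (+ 1) :+ xₐ :* y₀) :* u) :* ((con (+ 1) :+ x₀ :* y_b) :* v) :* w
              :- (con (+ 1) :+ x₀ :* y₀) :* ((con (+ 1) :+ xₐ :* y_b) :* w) :* u :* v) refl xₐ x₀ y_b y₀ u v w ⟩
    ((1# + xₐ * y₀) * u) * ((1# + x₀ * y_b) * v) * w - (1# + x₀ * y₀) * ((1# + xₐ * y_b) * w) * u * v
      ≈⟨ +-cong (*-congʳ (*-cong u-inv v-inv)) (-‿cong (*-congʳ (*-congʳ (*-congˡ w-inv)))) ⟩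
    1# * 1# * w - (1# + x₀ * y₀) * 1# * u * v
      ≈⟨ solve 5 (λ w x₀ y₀ u v → con (+ 1) :* con (+ 1) :* w :- (con (+ 1) :+ x₀ :* y₀) :* con (+ 1) :* u :* v
           := w :+ (:- ((con (+ 1) :+ x₀ :* y₀) :* u)) :* v) refl w x₀ y₀ u v ⟩
    w + (- ((1# + x₀ * y₀) * u)) * v ∎)

  det-cauchy : ∀ {n} (x y : Fin n → Carrier) → (∀ i j → ¬ ((1# + x i * y j) ≈ 0#)) →
    det (cauchy x y) ≈ ∏< (λ i j → x i - x j) * ∏< (λ i j → y j - y i) * ∏ (λ i → ∏ (λ j → inv (1# + x i * y j)))
  det-cauchy {zero}  x y _ = solve 0 (con (+ 1) := con (+ 1) :* con (+ 1) :* con (+ 1)) refl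
  det-cauchy {suc n} x y 1+xy≉0 = begin
    det C
      ≈⟨ det-addMultiplesOfFirstRow C l ⟨
    det C′
      ≈⟨ det-expandFirstColumn C′ firstColumn≈0 ⟩
    C′ zero zero * det (λ a b → C′ (suc a) (suc b))
      ≈⟨ *-cong (solve 1 (λ c → c :+ con (+ 0) :* c := c) refl (C zero zero)) (det-cong eliminated) ⟩
    C zero zero * det (λ a b → r a * cauchy x′ y′ a b * k b)
      ≈⟨ *-congˡ (trans (det-scaleColumns k (λ a b → r a * cauchy x′ y′ a b))
                        (*-congˡ (det-scaleRows r (cauchy x′ y′)))) ⟩
    C zero zero * (∏ k * (∏ r * det (cauchy x′ y′)))
      ≈⟨ *-congˡ (*-cong (∏-* (λ b → y′ b - y₀) (λ b → C zero (suc b)))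
                         (*-cong (∏-* (λ a → x₀ - x′ a) (λ a → C (suc a) zero))
                                 (det-cauchy x′ y′ (λ i j → 1+xy≉0 (suc i) (suc j))))) ⟩
    C zero zero * ((Δy₀ * I₀) * ((Δx₀ * I′) * (Δx′ * Δy′ * Π′)))
      ≈⟨ solve 8 (λ c Δy₀ I₀ Δx₀ I′ Δx′ Δy′ Π′ → c :* ((Δy₀ :* I₀) :* ((Δx₀ :* I′) :* (Δx′ :* Δy′ :* Π′)))
                   := (Δx₀ :* Δx′) :* (Δy₀ :* Δy′) :* ((c :* I₀) :* (I′ :* Π′)))
           refl (C zero zero) Δy₀ I₀ Δx₀ I′ Δx′ Δy′ Π′ ⟩
    (Δx₀ * Δx′) * (Δy₀ * Δy′) * ((C zero zero * I₀) * (I′ * Π′))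
      ≈⟨ *-cong (*-cong (∏<-split (λ i j → x i - x j)) (∏<-split (λ i j → y j - y i)))
                (*-congˡ (∏-* (λ a → C (suc a) zero) (λ a → ∏ (λ b → C (suc a) (suc b))))) ⟨
    ∏< (λ i j → x i - x j) * ∏< (λ i j → y j - y i) * ∏ (λ i → ∏ (λ j → inv (1# + x i * y j))) ∎
    where
    C = cauchy x y
    x₀ = x zero ; y₀ = y zero ; x′ = x ∘ suc ; y′ = y ∘ suc
    l = λ a → - ((1# + x₀ * y₀) * C (suc a) zero)
    C′ : Matrix (suc n)
    C′ a b = C a b + (0# ∷ l) a * C zero b
    r = λ a → (x₀ - x′ a) * C (suc a) zero
    k = λ b → (y′ b - y₀) * C zero (suc b)
    Δx₀ = ∏ (λ a → x₀ - x′ a)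
    Δy₀ = ∏ (λ b → y′ b - y₀)
    I′ = ∏ (λ a → C (suc a) zero)
    I₀ = ∏ (λ b → C zero (suc b))
    Δx′ = ∏< (λ i j → x′ i - x′ j)
    Δy′ = ∏< (λ i j → y′ j - y′ i)
    Π′ = ∏ (λ i → ∏ (λ j → inv (1# + x′ i * y′ j)))

    C-inv : ∀ a b → (1# + x a * y b) * C a b ≈ 1#
    C-inv a b = inverseʳ _ (1+xy≉0 a b)

    firstColumn≈0 : ∀ a → C′ (suc a) zero ≈ 0#
    firstColumn≈0 a = begin
      cₐ + (- ((1# + x₀ * y₀) * cₐ)) * C zero zero
        ≈⟨ solve 3 (λ c s d → c :+ (:- (s :* c)) :* d := c :- c :* (s :* d)) refl cₐ (1# + x₀ * y₀) (C zero zero) ⟩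
      cₐ - cₐ * ((1# + x₀ * y₀) * C zero zero)
        ≈⟨ +-congˡ (-‿cong (*-congˡ (C-inv zero zero))) ⟩
      cₐ - cₐ * 1#
        ≈⟨ solve 1 (λ c → c :- c :* con (+ 1) := con (+ 0)) refl cₐ ⟩
      0# ∎
      where cₐ = C (suc a) zero

    eliminated : ∀ a b → C′ (suc a) (suc b) ≈ r a * cauchy x′ y′ a b * k b
    eliminated a b = cauchy-elimination (x′ a) x₀ (y′ b) y₀ (C-inv (suc a) zero) (C-inv zero (suc b)) (C-inv (suc a) (suc b))

module BorderedCauchy {c ℓ} (F : Field c ℓ) where
  open Field F hiding (zero)
  open FieldOps F
  open Determinant F
  open Cauchy F
  open IntegerCoefficientSolver commutativeRing using (solve; _:=_; _:+_; _:*_; _:-_; :-_; con)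
  open import Algebra.Properties.Ring ring using (-1*x≈-x)
  open import Relation.Binary.Reasoning.Setoid setoid

  withCorner : ∀ {n} → Carrier → Matrix (suc n) → Matrix (suc n)
  withCorner t M zero    zero    = t
  withCorner t M zero    (suc j) = M zero (suc j)
  withCorner t M (suc i) j       = M (suc i) j

  det-withCorner : ∀ {n} t (M : Matrix (suc n)) →
    det (withCorner t M) ≈ t * det (λ a b → M (suc a) (suc b)) + det (withCorner 0# M)
  det-withCorner t M = solve 3 (λ t d e → t :* d :- e := t :* d :+ (con (+ 0) :* d :- e)) refl t _ _

  module _ {m} (x y : Fin m → Carrier) (1+xy≉0 : ∀ i j → ¬ ((1# + x i * y j) ≈ 0#)) where

    det-W-shiftedCorner : ∀ s → s * s ≈ 1# →
      det (withCorner (- s) (W x y)) ≈ - s * (∏ (λ j → 1# + s * y j) * (∏ (λ i → s + x i) * det (cauchy x y)))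
    det-W-shiftedCorner s s²≈1 = begin
      det (withCorner (- s) (W x y))
        ≈⟨ det-addMultiplesOfFirstRow (withCorner (- s) (W x y)) (λ _ → s) ⟨
      det M′
        ≈⟨ det-expandFirstColumn M′ firstColumn≈0 ⟩
      M′ zero zero * det (λ a b → M′ (suc a) (suc b))
        ≈⟨ *-cong (solve 1 (λ s → :- s :+ con (+ 0) :* :- s := :- s) refl s) (det-cong factorised) ⟩
      - s * det (λ a b → (s + x a) * cauchy x y a b * (1# + s * y b))
        ≈⟨ *-congˡ (trans (det-scaleColumns (λ b → 1# + s * y b) (λ a b → (s + x a) * cauchy x y a b))
                          (*-congˡ (det-scaleRows (λ a → s + x a) (cauchy x y)))) ⟩
      - s * (∏ (λ j → 1# + s * y j) * (∏ (λ i → s + x i) * det (cauchy x y))) ∎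
      where
      M′ : Matrix (suc m)
      M′ a b = withCorner (- s) (W x y) a b + (0# ∷ (λ _ → s)) a * withCorner (- s) (W x y) zero b

      firstColumn≈0 : ∀ a → M′ (suc a) zero ≈ 0#
      firstColumn≈0 a = begin
        1# + s * - s     ≈⟨ solve 1 (λ s → con (+ 1) :+ s :* :- s := con (+ 1) :- s :* s) refl s ⟩
        1# - s * s       ≈⟨ +-congˡ (-‿cong s²≈1) ⟩
        1# - 1#          ≈⟨ -‿inverseʳ 1# ⟩
        0#               ∎

      factorised : ∀ a b → M′ (suc a) (suc b) ≈ (s + x a) * cauchy x y a b * (1# + s * y b)
      factorised a b = sym (begin
        (s + x a) * u * (1# + s * y b)
          ≈⟨ solve 4 (λ s xₐ y_b u → (s :+ xₐ) :* u :* (con (+ 1) :+ s :* y_b)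
               := (xₐ :+ y_b) :* u :+ s :* ((con (+ 1) :+ xₐ :* y_b) :* u) :+ (s :* s :- con (+ 1)) :* (y_b :* u))
               refl s (x a) (y b) u ⟩
        (x a + y b) * u + s * ((1# + x a * y b) * u) + (s * s - 1#) * (y b * u)
          ≈⟨ +-cong (+-congˡ (*-congˡ (inverseʳ _ (1+xy≉0 a b)))) (*-congʳ (trans (+-congʳ s²≈1) (-‿inverseʳ 1#))) ⟩
        (x a + y b) * u + s * 1# + 0# * (y b * u)
          ≈⟨ solve 3 (λ e s f → e :+ s :* con (+ 1) :+ con (+ 0) :* f := e :+ s :* con (+ 1)) refl ((x a + y b) * u) s (y b * u) ⟩
        (x a + y b) * u + s * 1# ∎)
        where u = inv (1# + x a * y b)

    det-W-doubled : det (W x y) + det (W x y) ≈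
      (pow (- 1#) m * ∏ (λ i → 1# - x i) * ∏ (λ j → 1# - y j) - ∏ (λ i → 1# + x i) * ∏ (λ j → 1# + y j))
        * det (cauchy x y)
    det-W-doubled = begin
      det (W x y) + det (W x y)
        ≈⟨ +-cong W₀≈W W₀≈W ⟨
      det W₀ + det W₀
        ≈⟨ solve 2 (λ d z → z :+ z := (:- con (+ 1) :* d :+ z) :+ (:- :- con (+ 1) :* d :+ z)) refl D (det W₀) ⟩
      (- 1# * D + det W₀) + (- - 1# * D + det W₀)
        ≈⟨ +-cong (det-withCorner (- 1#) (W x y)) (det-withCorner (- - 1#) (W x y)) ⟨
      det (withCorner (- 1#) (W x y)) + det (withCorner (- - 1#) (W x y))
        ≈⟨ +-cong (det-W-shiftedCorner 1# (*-identityˡ 1#)) (det-W-shiftedCorner (- 1#) [-1]²≈1) ⟩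
      - 1# * (∏ (λ j → 1# + 1# * y j) * (Pˣ₊ * Dc))
        + - - 1# * (∏ (λ j → 1# + - 1# * y j) * (∏ (λ i → - 1# + x i) * Dc))
        ≈⟨ +-cong (*-congˡ (*-congʳ Pʸ₊-shifted)) (*-congˡ (*-cong Pʸ₋-shifted (*-congʳ Pˣ₋-shifted))) ⟩
      - 1# * (Pʸ₊ * (Pˣ₊ * Dc)) + - - 1# * (Pʸ₋ * (σ * Pˣ₋ * Dc))
        ≈⟨ solve 6 (λ p⁺ q⁺ p⁻ q⁻ σ d → :- con (+ 1) :* (q⁺ :* (p⁺ :* d)) :+ :- :- con (+ 1) :* (q⁻ :* (σ :* p⁻ :* d))
                                        := (σ :* p⁻ :* q⁻ :- p⁺ :* q⁺) :* d)
             refl Pˣ₊ Pʸ₊ Pˣ₋ Pʸ₋ σ Dc ⟩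
      (σ * Pˣ₋ * Pʸ₋ - Pˣ₊ * Pʸ₊) * Dc ∎
      where
      W₀ = withCorner 0# (W x y)
      D = det (λ a b → W x y (suc a) (suc b))
      Dc = det (cauchy x y)
      σ = pow (- 1#) m
      Pˣ₊ = ∏ (λ i → 1# + x i)
      Pʸ₊ = ∏ (λ j → 1# + y j)
      Pˣ₋ = ∏ (λ i → 1# - x i)
      Pʸ₋ = ∏ (λ j → 1# - y j)

      W₀≈W : det W₀ ≈ det (W x y)
      W₀≈W = det-cong {M = W₀} {N = W x y} λ { zero zero → refl ; zero (suc b) → refl ; (suc a) b → refl }

      [-1]²≈1 : - 1# * - 1# ≈ 1#
      [-1]²≈1 = solve 0 (:- con (+ 1) :* :- con (+ 1) := con (+ 1)) refl

      Pʸ₊-shifted : ∏ (λ j → 1# + 1# * y j) ≈ Pʸ₊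
      Pʸ₊-shifted = ∏-cong (λ j → +-congˡ (*-identityˡ (y j)))

      Pʸ₋-shifted : ∏ (λ j → 1# + - 1# * y j) ≈ Pʸ₋
      Pʸ₋-shifted = ∏-cong (λ j → +-congˡ (-1*x≈-x (y j)))

      Pˣ₋-shifted : ∏ (λ i → - 1# + x i) ≈ σ * Pˣ₋
      Pˣ₋-shifted = trans (∏-cong (λ i → solve 1 (λ x → :- con (+ 1) :+ x := :- (con (+ 1) :- x)) refl (x i)))
                          (∏-neg (λ i → 1# - x i))

  x+x≈e⇒x≈e/2 : ¬ ((1# + 1#) ≈ 0#) → ∀ {x e} → x + x ≈ e → x ≈ inv (1# + 1#) * e
  x+x≈e⇒x≈e/2 2≉0 {x} {e} x+x≈e = begin
    x                    ≈⟨ *-identityˡ x ⟨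
    1# * x               ≈⟨ *-congʳ (inverseʳ (1# + 1#) 2≉0) ⟨
    ((1# + 1#) * ½) * x  ≈⟨ solve 2 (λ h x → ((con (+ 1) :+ con (+ 1)) :* h) :* x := h :* (x :+ x)) refl ½ x ⟩
    ½ * (x + x)          ≈⟨ *-congˡ x+x≈e ⟩
    ½ * e                ∎
    where ½ = inv (1# + 1#)

open BorderedCauchy using (det-W-doubled; x+x≈e⇒x≈e/2)
open Cauchy using (cauchy; det-cauchy)

theorem4 : ∀ {c ℓ} (F : Field c ℓ) → let open Field F in let open FieldOps F in
    ¬ ((1# + 1#) ≈ 0#) →
    (m : ℕ) → m ≥ 1 → (x y : Fin m → Carrier) →
    (∀ i j → ¬ ((1# + x i * y j) ≈ 0#)) →
    (∀ i → ¬ ((1# + x i) ≈ 0#)) →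
    (∀ j → ¬ ((1# + y j) ≈ 0#)) →
    det (W x y) ≈
      ((- inv (1# + 1#)) *
        (∏ (λ i → 1# + x i) * ∏ (λ j → 1# + y j)
          - pow (- 1#) m * ∏ (λ i → 1# - x i) * ∏ (λ j → 1# - y j)))
      * ∏< (λ i j → x i - x j)
      * ∏< (λ i j → y j - y i)
      * ∏ (λ i → ∏ (λ j → inv (1# + x i * y j)))
theorem4 F 2≉0 m _ x y 1+xy≉0 _ _ = begin
  det (W x y)
    ≈⟨ x+x≈e⇒x≈e/2 F 2≉0 (det-W-doubled F x y 1+xy≉0) ⟩
  ½ * ((Q⁻ - Q⁺) * det (cauchy F x y))
    ≈⟨ *-congˡ (*-congˡ (det-cauchy F x y 1+xy≉0)) ⟩
  ½ * ((Q⁻ - Q⁺) * (Δx * Δy * Π))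
    ≈⟨ solve 6 (λ h q⁻ q⁺ Δx Δy Π → h :* ((q⁻ :- q⁺) :* (Δx :* Δy :* Π))
                                    := (:- h :* (q⁺ :- q⁻)) :* Δx :* Δy :* Π) refl ½ Q⁻ Q⁺ Δx Δy Π ⟩
  (- ½ * (Q⁺ - Q⁻)) * Δx * Δy * Π ∎
  where
  open Field F hiding (zero)
  open FieldOps F
  open IntegerCoefficientSolver commutativeRing using (solve; _:=_; _:+_; _:*_; _:-_; :-_; con)
  open import Relation.Binary.Reasoning.Setoid setoid
  ½ = inv (1# + 1#)
  Q⁺ = ∏ (λ i → 1# + x i) * ∏ (λ j → 1# + y j)
  Q⁻ = pow (- 1#) m * ∏ (λ i → 1# - x i) * ∏ (λ j → 1# - y j)
  Δx = ∏< (λ i j → x i - x j)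
  Δy = ∏< (λ i j → y j - y i)
  Π = ∏ (λ i → ∏ (λ j → inv (1# + x i * y j)))
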